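{- For every $n \geq 1$ and all $u, v \in \mathsf{Tr}(n)$, the word $r := \max(u_1,v_1)\max(u_2,v_2)\cdots\max(u_n,v_n)$ is a triword and is the join of $u$ and $v$ in $(\mathsf{Tr}(n),\preccurlyeq)$; consequently $(\mathsf{Tr}(n),\preccurlyeq)$ is a lattice.
   Context: For $n\ge1$, $\mathsf{Tr}(n)$ (triwords of size $n$) is the set of words $u = u_1\cdots u_n$ over $\{0,1,2\}$ with $u_1 \neq 2$ and such that there are no indices $i<j$ with $u_i = 0$ and $u_j = 1$. The order $\preccurlyeq$ on $\mathsf{Tr}(n)$ is componentwise: $u \preccurlyeq v$ iff $u_i \leq v_i$ for all $i \in \{1,\dots,n\}$. -}

module Defs where

open import Data.Nat using (ℕ; suc)
open import Data.Fin using (Fin; zero; suc; _≤_; _≤?_)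
open import Data.Product using (_×_; Σ; _,_)
open import Relation.Nullary using (¬_; yes; no)
open import Relation.Binary.PropositionalEquality using (_≡_)

-- Letters 0,1,2 are the elements of Fin 3; a word of size n is a function Fin n → Fin 3
-- (position i ↦ letter u_{i+1}).
Word : ℕ → Set
Word n = Fin n → Fin 3

l0 l1 l2 : Fin 3
l0 = zero
l1 = suc zero
l2 = suc (suc zero)

IsTriword : {n : ℕ} → Word (suc n) → Set
IsTriword {n} u =
  (¬ (u zero ≡ l2)) ×
  (∀ (i j : Fin (suc n)) → Data.Fin._<_ i j → u i ≡ l0 → ¬ (u j ≡ l1))

_≼_ : {n : ℕ} → Word n → Word n → Set
u ≼ v = ∀ i → u i ≤ v i

maxL : Fin 3 → Fin 3 → Fin 3
maxL a b with a ≤? b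
... | yes _ = b
... | no _ = a

maxW : {n : ℕ} → Word n → Word n → Word n
maxW u v i = maxL (u i) (v i)

IsJoinTr : {n : ℕ} → Word (suc n) → Word (suc n) → Word (suc n) → Set
IsJoinTr {n} u v r =
  IsTriword r × (u ≼ r) × (v ≼ r) ×
  (∀ (w : Word (suc n)) → IsTriword w → u ≼ w → v ≼ w → r ≼ w)

IsMeetTr : {n : ℕ} → Word (suc n) → Word (suc n) → Word (suc n) → Set
IsMeetTr {n} u v m =
  IsTriword m × (m ≼ u) × (m ≼ v) ×
  (∀ (w : Word (suc n)) → IsTriword w → w ≼ u → w ≼ v → w ≼ m)

IsLatticeTr : ℕ → Set
IsLatticeTr n =
  ∀ (u v : Word (suc n)) → IsTriword u → IsTriword v →
    Σ (Word (suc n)) (IsJoinTr u v) × Σ (Word (suc n)) (IsMeetTr u v)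

module Submission where

-- Letters are ordered 0 < 1 < 2 and words are compared letterwise,
-- so among ALL words the letterwise maximum (minimum) of u and v is the join
-- (meet).  The join part of the theorem then only needs that the letterwise
-- maximum of two triwords is again a triword: its first letter is one of the
-- first letters of u, v (so ≠ 2), and a 0 at position i forces 0 in both u and
-- v at i while a 1 at a later position j is a 1 of u or of v at j.
-- The letterwise minimum of two triwords need not be a triword (the minimum of
-- 02 and 11 is 01), so for the meet we use the triword core of a word c:
-- every letter 1 of c preceded by some 0 of c is lowered to 0.  The core is the
-- greatest triword below c whenever c starts with a letter ≠ 2.  The meet of
-- triwords u, v is then the core of their letterwise minimum.

open import Defs
open import Data.Nat using (ℕ; suc; z≤n; s≤s)
open import Data.Nat.Properties using (≰⇒≥)
open import Data.Product using (_×_; _,_; ∃)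
open import Data.Sum using (_⊎_; inj₁; inj₂)
open import Data.Fin using (Fin; zero; suc; _≤_; _<_; _≤?_)
open import Data.Fin.Properties using (≤-refl; ≤-trans; <-trans; _<?_; _≟_; any?)
open import Data.Empty using (⊥-elim)
open import Relation.Nullary using (¬_; Dec; yes; no)
open import Relation.Nullary.Decidable using (_×-dec_)
open import Relation.Binary.PropositionalEquality using (_≡_; refl)

Letter : Set
Letter = Fin 3

two-upward : {a b : Letter} → a ≤ b → a ≡ l2 → b ≡ l2
two-upward {b = suc (suc zero)} _ _ = refl
two-upward {b = zero} () refl
two-upward {b = suc zero} (s≤s ()) refl

zero-downward : {a b : Letter} → a ≤ b → b ≡ l0 → a ≡ l0
zero-downward {zero} _ _ = refl
zero-downward {suc a} () refl

maxL-upperˡ : (a b : Letter) → a ≤ maxL a b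
maxL-upperˡ a b with a ≤? b
... | yes a≤b = a≤b
... | no _ = ≤-refl

maxL-upperʳ : (a b : Letter) → b ≤ maxL a b
maxL-upperʳ a b with a ≤? b
... | yes _ = ≤-refl
... | no a≰b = ≰⇒≥ a≰b

maxL-least : {a b c : Letter} → a ≤ c → b ≤ c → maxL a b ≤ c
maxL-least {a} {b} a≤c b≤c with a ≤? b
... | yes _ = b≤c
... | no _ = a≤c

maxL-selective : (a b : Letter) {x : Letter} → maxL a b ≡ x → a ≡ x ⊎ b ≡ x
maxL-selective a b e with a ≤? b
... | yes _ = inj₂ e
... | no _ = inj₁ e

minF : {k : ℕ} → Fin k → Fin k → Fin k
minF a b with a ≤? b
... | yes _ = a
... | no _ = b

minF-lowerˡ : {k : ℕ} (a b : Fin k) → minF a b ≤ a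
minF-lowerˡ a b with a ≤? b
... | yes _ = ≤-refl
... | no a≰b = ≰⇒≥ a≰b

minF-lowerʳ : {k : ℕ} (a b : Fin k) → minF a b ≤ b
minF-lowerʳ a b with a ≤? b
... | yes a≤b = a≤b
... | no _ = ≤-refl

minF-greatest : {k : ℕ} {a b c : Fin k} → c ≤ a → c ≤ b → c ≤ minF a b
minF-greatest {a = a} {b} c≤a c≤b with a ≤? b
... | yes _ = c≤a
... | no _ = c≤b

maxW-triword : {m : ℕ} (u v : Word (suc m)) →
  IsTriword u → IsTriword v → IsTriword (maxW u v)
maxW-triword u v (u₀≢2 , u-ok) (v₀≢2 , v-ok) = first≢2 , no01
  where
  first≢2 : ¬ maxW u v zero ≡ l2
  first≢2 e with maxL-selective (u zero) (v zero) e
  ... | inj₁ u₀≡2 = u₀≢2 u₀≡2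
  ... | inj₂ v₀≡2 = v₀≢2 v₀≡2

  no01 : ∀ i j → i < j → maxW u v i ≡ l0 → ¬ maxW u v j ≡ l1
  no01 i j i<j rᵢ≡0 rⱼ≡1 with maxL-selective (u j) (v j) rⱼ≡1
  ... | inj₁ uⱼ≡1 = u-ok i j i<j (zero-downward (maxL-upperˡ (u i) (v i)) rᵢ≡0) uⱼ≡1
  ... | inj₂ vⱼ≡1 = v-ok i j i<j (zero-downward (maxL-upperʳ (u i) (v i)) rᵢ≡0) vⱼ≡1

maxW-join : {m : ℕ} (u v : Word (suc m)) →
  IsTriword u → IsTriword v → IsJoinTr u v (maxW u v)
maxW-join u v tu tv =
  maxW-triword u v tu tv ,
  (λ j → maxL-upperˡ (u j) (v j)) ,
  (λ j → maxL-upperʳ (u j) (v j)) ,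
  (λ w _ u≼w v≼w j → maxL-least (u≼w j) (v≼w j))

minW : {n : ℕ} → Word n → Word n → Word n
minW u v j = minF (u j) (v j)

minW-greatest : {n : ℕ} {u v w : Word n} → w ≼ u → w ≼ v → w ≼ minW u v
minW-greatest w≼u w≼v j = minF-greatest (w≼u j) (w≼v j)

lowerOne : Letter → Letter
lowerOne (suc zero) = zero
lowerOne a = a

lowerOne-≤ : (a : Letter) → lowerOne a ≤ a
lowerOne-≤ zero = z≤n
lowerOne-≤ (suc zero) = z≤n
lowerOne-≤ (suc (suc zero)) = s≤s (s≤s z≤n)

lowerOne-≢1 : (a : Letter) → ¬ lowerOne a ≡ l1
lowerOne-≢1 zero ()
lowerOne-≢1 (suc zero) ()
lowerOne-≢1 (suc (suc zero)) ()

lowerOne-greatest : {a w : Letter} → w ≤ a → ¬ w ≡ l1 → w ≤ lowerOne a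
lowerOne-greatest {zero} w≤a _ = w≤a
lowerOne-greatest {suc (suc zero)} w≤a _ = w≤a
lowerOne-greatest {suc zero} {zero} _ _ = z≤n
lowerOne-greatest {suc zero} {suc zero} _ w≢1 = ⊥-elim (w≢1 refl)
lowerOne-greatest {suc zero} {suc (suc zero)} (s≤s ())

lowerIf : {A : Set} → Dec A → Letter → Letter
lowerIf (yes _) a = lowerOne a
lowerIf (no _) a = a

lowerIf-≤ : {A : Set} (d : Dec A) (a : Letter) → lowerIf d a ≤ a
lowerIf-≤ (yes _) a = lowerOne-≤ a
lowerIf-≤ (no _) a = ≤-refl

module Core {m : ℕ} (c : Word (suc m)) where

  EarlierZero : Fin (suc m) → Set
  EarlierZero j = ∃ λ i → (i < j) × (c i ≡ l0)

  earlierZero? : (j : Fin (suc m)) → Dec (EarlierZero j)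
  earlierZero? j = any? (λ i → (i <? j) ×-dec (c i ≟ l0))

  core : Word (suc m)
  core j = lowerIf (earlierZero? j) (c j)

  core-≼ : core ≼ c
  core-≼ j = lowerIf-≤ (earlierZero? j) (c j)

  core-one : ∀ j → core j ≡ l1 → (c j ≡ l1) × ¬ EarlierZero j
  core-one j e with earlierZero? j
  ... | yes _ = ⊥-elim (lowerOne-≢1 (c j) e)
  ... | no ¬E = e , ¬E

  core-zero : ∀ i j → i < j → core i ≡ l0 → EarlierZero j
  core-zero i j i<j e with earlierZero? i
  ... | yes (k , k<i , cₖ≡0) = k , <-trans k<i i<j , cₖ≡0
  ... | no _ = i , i<j , e

  core-triword : ¬ c zero ≡ l2 → IsTriword core
  core-triword c₀≢2 = (λ e → c₀≢2 (two-upward (core-≼ zero) e)) , no01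
    where
    no01 : ∀ i j → i < j → core i ≡ l0 → ¬ core j ≡ l1
    no01 i j i<j coreᵢ≡0 coreⱼ≡1 with core-one j coreⱼ≡1
    ... | _ , ¬E = ¬E (core-zero i j i<j coreᵢ≡0)

  -- Every triword below c is below its core: after a 0 of c, a triword below c
  -- has 0 there too, so it cannot carry a 1 later.
  core-greatest : (w : Word (suc m)) → IsTriword w → w ≼ c → w ≼ core
  core-greatest w (_ , w-ok) w≼c j with earlierZero? j
  ... | no _ = w≼c j
  ... | yes (i , i<j , cᵢ≡0) =
    lowerOne-greatest (w≼c j) (w-ok i j i<j (zero-downward (w≼c i) cᵢ≡0))

open Core using (core; core-≼; core-triword; core-greatest)

core-minW-meet : {m : ℕ} (u v : Word (suc m)) →
  IsTriword u → IsTriword v → IsMeetTr u v (core (minW u v))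
core-minW-meet u v (u₀≢2 , _) _ =
  core-triword (minW u v) min₀≢2 ,
  (λ j → ≤-trans (core-≼ (minW u v) j) (minF-lowerˡ (u j) (v j))) ,
  (λ j → ≤-trans (core-≼ (minW u v) j) (minF-lowerʳ (u j) (v j))) ,
  (λ w tw w≼u w≼v → core-greatest (minW u v) w tw (minW-greatest w≼u w≼v))
  where
  min₀≢2 : ¬ minW u v zero ≡ l2
  min₀≢2 e = u₀≢2 (two-upward (minF-lowerˡ (u zero) (v zero)) e)

mainTheorem2 : (m : ℕ) →
    ((u v : Word (suc m)) → IsTriword u → IsTriword v → IsJoinTr u v (maxW u v))
    × IsLatticeTr m
mainTheorem2 m =
  maxW-join ,
  λ u v tu tv → (maxW u v , maxW-join u v tu tv) , (core (minW u v) , core-minW-meet u v tu tv)
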